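{- For the fan graph $F_{1,r}=K_1+P_r$ with $r\ge 3$, $pd_s(F_{1,r})=3$ if $r\in\{3,4\}$, and $pd_s(F_{1,r})=\lceil r/2\rceil$ if $r\ge 5$.
   Context: Graphs are finite, simple, connected; $d_G$ is shortest-path distance, $d_G(x,W)=\min\{d_G(x,w):w\in W\}$. A set $W$ strongly resolves different vertices $x,y\notin W$ if $d_G(x,W)=d_G(x,y)+d_G(y,W)$ or $d_G(y,W)=d_G(y,x)+d_G(x,W)$. A vertex partition $\Pi$ is a strong resolving partition if every two different vertices in the same set of $\Pi$ are strongly resolved by some set of $\Pi$; $pd_s(G)$ is the minimum cardinality of such a partition. $K_1+P_r$ is the graph obtained from a path $P_r$ on $r$ vertices and one additional vertex adjacent to all vertices of the path. -}

module Defs where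

open import Data.Nat using (ℕ; zero; suc; _+_; _∸_; _⊓_; _≡ᵇ_)
open import Data.Bool using (Bool; true; false; _∧_; _∨_; if_then_else_)
open import Data.Fin using (Fin; zero; suc; toℕ)
open import Data.Fin.Properties using (_≟_)
open import Data.List using (List; []; _∷_; foldr; filter; map; allFin)
open import Data.Product using (Σ; ∃; _×_)
open import Relation.Nullary using (¬_; does)
open import Relation.Binary.PropositionalEquality using (_≡_)

record Graph : Set where
  field
    n   : ℕ
    adj : Fin n → Fin n → Bool
open Graph public

reach : (G : Graph) → ℕ → Fin (n G) → Fin (n G) → Bool
reach G zero    x y = does (x ≟ y)
reach G (suc k) x y =
  reach G k x y ∨ foldr (λ z b → (adj G x z ∧ reach G k z y) ∨ b) false (allFin (n G))

-- least k in [i, i + fuel] with reach k x y (returns i + fuel if none)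
search : (G : Graph) → Fin (n G) → Fin (n G) → ℕ → ℕ → ℕ
search G x y i zero       = i
search G x y i (suc fuel) = if reach G i x y then i else search G x y (suc i) fuel

-- Shortest-path distance d_G(x,y): the least k with a walk of length k from x to y.
-- (In a connected graph on n vertices it is < n, so searching k = 0..n suffices.)
dist : (G : Graph) → Fin (n G) → Fin (n G) → ℕ
dist G x y = search G x y 0 (n G)

-- minimum of a list of naturals; the default only matters for the empty list
minList : ℕ → List ℕ → ℕ
minList d []       = d
minList d (a ∷ as) = foldr _⊓_ a as

-- A partition into k (labelled) classes: class t is { v | c v ≡ t }.
-- d_G(x, W_t) = min { d_G(x,w) : c w ≡ t }  (classes are nonempty for partitions)
distClass : (G : Graph) {k : ℕ} → (Fin (n G) → Fin k) → Fin (n G) → Fin k → ℕ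
distClass G c x t =
  minList 0 (map (dist G x) (filter (λ w → c w ≟ t) (allFin (n G))))

StronglyResolves : (G : Graph) {k : ℕ} → (Fin (n G) → Fin k) → Fin k → Fin (n G) → Fin (n G) → Set
StronglyResolves G c t x y =
  (distClass G c x t ≡ dist G x y + distClass G c y t) Data.Sum.⊎
  (distClass G c y t ≡ dist G y x + distClass G c x t)
  where import Data.Sum

IsPartition : (G : Graph) {k : ℕ} → (Fin (n G) → Fin k) → Set
IsPartition G {k} c = (t : Fin k) → ∃ λ v → c v ≡ t

IsStrongResolvingPartition : (G : Graph) {k : ℕ} → (Fin (n G) → Fin k) → Set
IsStrongResolvingPartition G {k} c =
  IsPartition G c ×
  ((x y : Fin (n G)) → ¬ (x ≡ y) → c x ≡ c y →
     ∃ λ (t : Fin k) → ¬ (t ≡ c x) × StronglyResolves G c t x y)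

StrongPartitionDimension : Graph → ℕ → Set
StrongPartitionDimension G m =
  (Σ (Fin (n G) → Fin m) (IsStrongResolvingPartition G)) ×
  ((k : ℕ) (c : Fin (n G) → Fin k) → IsStrongResolvingPartition G c → m Data.Nat.≤ k)
  where import Data.Nat

adjNat : ℕ → ℕ → Bool
adjNat a b = (suc a ≡ᵇ b) ∨ (suc b ≡ᵇ a)

-- Fan graph F_{1,r} = K_1 + P_r on Fin (suc r):
-- vertex zero is the K_1 vertex, vertex suc i is the i-th path vertex (i = 0..r-1).
fanAdj : (r : ℕ) → Fin (suc r) → Fin (suc r) → Bool
fanAdj r zero    zero    = false
fanAdj r zero    (suc j) = true
fanAdj r (suc i) zero    = true
fanAdj r (suc i) (suc j) = adjNat (toℕ i) (toℕ j)

fan : ℕ → Graph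
fan r = record { n = suc r ; adj = fanAdj r }

-- Any two vertices of a fan have the hub as a common neighbour, so all distances are
-- at most 2.  In a graph of diameter ≤ 2 a class W can strongly resolve x, y ∉ W only
-- when d(x,y) = 1 (as d(x,W) ≤ 2 and d(y,W) ≥ 1), so the classes of a strong resolving
-- partition are cliques; the ⌈r/2⌉ path vertices at even positions are pairwise
-- non-adjacent, whence pd_s ≥ ⌈r/2⌉.  For r ≥ 5 the path pairs {p_2m, p_2m+1}, with the
-- hub joining the last pair, form a strong resolving partition: each pair is resolved by
-- a neighbouring pair and the hub by {p_0, p_1}.  For r ∈ {3, 4} an explicit 3-partition
-- and the absence of 2-partitions are verified by evaluation.

module Submission where

open import Defs
open import Data.Nat
  using (ℕ; zero; suc; _+_; _≤_; _<_; z≤n; s≤s; s≤s⁻¹; ⌊_/2⌋; ⌈_/2⌉; _≡ᵇ_)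
open import Data.Nat.Properties
  using (≤-refl; ≤-trans; ≤-reflexive; ≤-antisym; ≤⇒≯; ≰⇒>; ≤-<-connex; <-cmp; <⇒≤; <⇒≢;
         m≤n⇒m≤1+n; m≤n⇒m<n∨m≡n; n≤0⇒n≡0; n≤1+n; 1+n≰n; 1+n≢n; m+n≤o⇒m≤o;
         +-suc; +-identityʳ; +-mono-≤;
         m⊓n≤m; m≤n⇒o⊓m≤n; ⊓-glb; ⌈n/2⌉-mono; n≡⌊n+n/2⌋; n≡⌈n+n/2⌉)
  renaming (_≟_ to _≟ℕ_)
open import Data.Bool using (Bool; true; false; _∧_; _∨_)
open import Data.Bool.Properties using (∨-zeroʳ)
open import Data.Fin using (Fin; zero; suc; toℕ; fromℕ; fromℕ<; #_)
open import Data.Fin.Properties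
  using (_≟_; all?; any?; toℕ-fromℕ; toℕ-fromℕ<; toℕ<n; toℕ-injective; suc-injective;
         injective⇒≤)
open import Data.List using (List; []; _∷_; foldr; filter; map; allFin)
open import Data.List.Properties using (filter-≐)
open import Data.List.Membership.Propositional using (_∈_)
open import Data.List.Membership.Propositional.Properties
  using (∈-allFin; ∈-map⁺; ∈-map⁻; ∈-filter⁺; ∈-filter⁻)
open import Data.List.Relation.Unary.Any using (here; there)
open import Data.Vec using (Vec; []; _∷_; lookup; tabulate)
open import Data.Vec.Properties using (lookup∘tabulate)
open import Data.Product using (∃; _×_; _,_; proj₁; proj₂)
open import Data.Sum using (_⊎_; inj₁; inj₂)
open import Data.Empty using (⊥-elim)
open import Data.Unit using (tt)
open import Relation.Binary using (tri<; tri≈; tri>)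
open import Relation.Nullary using (¬_; Dec; yes; no)
open import Relation.Nullary.Decidable
  using (dec-true; dec-false; map′; _×-dec_; _⊎-dec_; _→-dec_; ¬?; toWitness)
open import Relation.Binary.PropositionalEquality
  using (_≡_; _≢_; refl; sym; trans; cong; cong₂; subst; subst₂; module ≡-Reasoning)

∨-fold-intro : {A : Set} (f : A → Bool) {xs : List A} {z : A} → z ∈ xs → f z ≡ true →
               foldr (λ z b → f z ∨ b) false xs ≡ true
∨-fold-intro f (here refl) fz rewrite fz = refl
∨-fold-intro f {x ∷ _} (there z∈xs) fz rewrite ∨-fold-intro f z∈xs fz = ∨-zeroʳ (f x)

∨-fold-elim : {A : Set} (f : A → Bool) (xs : List A) →
              foldr (λ z b → f z ∨ b) false xs ≡ true → ∃ λ z → f z ≡ true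
∨-fold-elim f [] ()
∨-fold-elim f (x ∷ xs) e with f x in fx
... | true  = x , fx
... | false = ∨-fold-elim f xs e

distinct⇒2≤ : ∀ {m} {x y : Fin m} → x ≢ y → 2 ≤ m
distinct⇒2≤ {suc zero}    {zero} {zero} x≢y = ⊥-elim (x≢y refl)
distinct⇒2≤ {suc (suc m)} _ = s≤s (s≤s z≤n)

module Walks (G : Graph) where

  V : Set
  V = Fin (n G)

  reach-refl : (x : V) → reach G 0 x x ≡ true
  reach-refl x = dec-true (x ≟ x) refl

  reach0-distinct : {x y : V} → x ≢ y → reach G 0 x y ≡ false
  reach0-distinct {x} {y} = dec-false (x ≟ y)

  reach-edge : {x y : V} → adj G x y ≡ true → reach G 1 x y ≡ true
  reach-edge {x} {y} xy =
    trans (cong (reach G 0 x y ∨_) (∨-fold-intro _ (∈-allFin y) last-step)) (∨-zeroʳ _)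
    where
    last-step : adj G x y ∧ reach G 0 y y ≡ true
    last-step rewrite xy | reach-refl y = refl

  reach-two : {x z y : V} → adj G x z ≡ true → adj G z y ≡ true → reach G 2 x y ≡ true
  reach-two {x} {z} {y} xz zy =
    trans (cong (reach G 1 x y ∨_) (∨-fold-intro _ (∈-allFin z) first-step)) (∨-zeroʳ _)
    where
    first-step : adj G x z ∧ reach G 1 z y ≡ true
    first-step rewrite xz | reach-edge zy = refl

  edge-into : {x z y : V} → adj G x z ∧ reach G 0 z y ≡ true → adj G x y ≡ true
  edge-into {x} {z} {y} e with adj G x z in xz | z ≟ y
  ... | true  | yes refl = xz
  edge-into () | true  | no _
  edge-into () | false | _

  reach1-nonadjacent : {x y : V} → x ≢ y → adj G x y ≡ false → reach G 1 x y ≡ false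
  reach1-nonadjacent {x} {y} x≢y xy rewrite reach0-distinct x≢y
    with foldr (λ z b → (adj G x z ∧ reach G 0 z y) ∨ b) false (allFin (n G)) in e
  ... | false = refl
  ... | true with ∨-fold-elim _ (allFin (n G)) e
  ...   | z , xzy with () ← trans (sym (edge-into xzy)) xy

  search-≤ : ∀ {x y : V} {i k} f → i ≤ k → reach G k x y ≡ true → search G x y i f ≤ k
  search-≤ zero i≤k _ = i≤k
  search-≤ {x} {y} {i} (suc f) i≤k hit with reach G i x y in miss
  ... | true  = i≤k
  ... | false with m≤n⇒m<n∨m≡n i≤k
  ...   | inj₁ i<k  = search-≤ f i<k hit
  ...   | inj₂ refl with () ← trans (sym miss) hit

  search-≥ : ∀ {x y : V} {k} i f → (∀ j → j < k → reach G j x y ≡ false) → k ≤ i + f →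
             k ≤ search G x y i f
  search-≥ i zero _ k≤i rewrite +-identityʳ i = k≤i
  search-≥ {x} {y} {k} i (suc f) below k≤i+f with reach G i x y in hit
  ... | false = search-≥ (suc i) f below (≤-trans k≤i+f (≤-reflexive (+-suc i f)))
  ... | true with ≤-<-connex k i
  ...   | inj₁ k≤i = k≤i
  ...   | inj₂ i<k with () ← trans (sym hit) (below i i<k)

  -- Consequently d_G(x,y) is bounded by any walk length, and is at least k when no
  -- shorter walk exists (k ≤ |V| so that the search does not run out of fuel).
  dist-≤ : ∀ {x y : V} {k} → reach G k x y ≡ true → dist G x y ≤ k
  dist-≤ = search-≤ (n G) z≤n

  dist-≥ : ∀ {x y : V} {k} → (∀ j → j < k → reach G j x y ≡ false) → k ≤ n G → k ≤ dist G x y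
  dist-≥ below k≤n = search-≥ 0 (n G) below k≤n

  dist-self : (x : V) → dist G x x ≡ 0
  dist-self x = n≤0⇒n≡0 (dist-≤ (reach-refl x))

  dist-distinct : {x y : V} → x ≢ y → 1 ≤ dist G x y
  dist-distinct {x} {y} x≢y = dist-≥ below (≤-trans (s≤s z≤n) (distinct⇒2≤ x≢y))
    where
    below : ∀ j → j < 1 → reach G j x y ≡ false
    below zero _ = reach0-distinct x≢y
    below (suc _) (s≤s ())

  dist-edge : {x y : V} → x ≢ y → adj G x y ≡ true → dist G x y ≡ 1
  dist-edge x≢y xy = ≤-antisym (dist-≤ (reach-edge xy)) (dist-distinct x≢y)

  dist-nonadjacent : {x y : V} → x ≢ y → adj G x y ≡ false → 2 ≤ dist G x y
  dist-nonadjacent {x} {y} x≢y xy = dist-≥ below (distinct⇒2≤ x≢y)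
    where
    below : ∀ j → j < 2 → reach G j x y ≡ false
    below zero          _ = reach0-distinct x≢y
    below (suc zero)    _ = reach1-nonadjacent x≢y xy
    below (suc (suc _)) (s≤s (s≤s ()))

  dist-common-neighbour : {x z y : V} → adj G x z ≡ true → adj G z y ≡ true → dist G x y ≤ 2
  dist-common-neighbour xz zy = dist-≤ (reach-two xz zy)

minList-≤ : ∀ {L e} → e ∈ L → minList 0 L ≤ e
minList-≤ {a ∷ []}     (here refl)         = ≤-refl
minList-≤ {a ∷ b ∷ bs} (here refl)         = m≤n⇒o⊓m≤n b (minList-≤ {a ∷ bs} (here refl))
minList-≤ {a ∷ b ∷ bs} (there (here refl)) = m⊓n≤m b _
minList-≤ {a ∷ b ∷ bs} (there (there e∈)) = m≤n⇒o⊓m≤n b (minList-≤ {a ∷ bs} (there e∈))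

minList-≥ : ∀ {L e m} → e ∈ L → (∀ {e'} → e' ∈ L → m ≤ e') → m ≤ minList 0 L
minList-≥ {a ∷ []}     _ bound = bound (here refl)
minList-≥ {a ∷ b ∷ bs} _ bound =
  ⊓-glb (bound (there (here refl)))
        (minList-≥ {a ∷ bs} (here refl) λ { (here refl) → bound (here refl)
                                          ; (there e∈) → bound (there (there e∈)) })

module Classes (G : Graph) {k : ℕ} (c : Fin (n G) → Fin k) where
  open Walks G

  private
    member : ∀ {x w t} → c w ≡ t →
             dist G x w ∈ map (dist G x) (filter (λ w → c w ≟ t) (allFin (n G)))
    member {x} {w} {t} cw = ∈-map⁺ (dist G x) (∈-filter⁺ (λ w → c w ≟ t) (∈-allFin w) cw)

  distClass-≤ : ∀ {x w t} → c w ≡ t → distClass G c x t ≤ dist G x w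
  distClass-≤ cw = minList-≤ (member cw)

  distClass-≥ : ∀ {x w t m} → c w ≡ t → (∀ w' → c w' ≡ t → m ≤ dist G x w') →
                m ≤ distClass G c x t
  distClass-≥ {x} {t = t} {m} cw bound = minList-≥ (member cw) lower
    where
    lower : ∀ {e} → e ∈ map (dist G x) (filter (λ w → c w ≟ t) (allFin (n G))) → m ≤ e
    lower e∈ with ∈-map⁻ (dist G x) e∈
    ... | w' , w'∈ , refl = bound w' (proj₂ (∈-filter⁻ (λ w → c w ≟ t) {xs = allFin (n G)} w'∈))

  distClass-outside : ∀ {x w t} → c w ≡ t → c x ≢ t → 1 ≤ distClass G c x t
  distClass-outside cw cx≢t =
    distClass-≥ cw λ w' cw' → dist-distinct λ { refl → cx≢t cw' }

  Resolved : Fin (n G) → Fin (n G) → Set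
  Resolved x y = ∃ λ t → ¬ t ≡ c x × StronglyResolves G c t x y

  resolved-swap : ∀ {x y} → c x ≡ c y → Resolved y x → Resolved x y
  resolved-swap cxy (t , t≢cy , inj₁ e) = t , (λ t≡cx → t≢cy (trans t≡cx cxy)) , inj₂ e
  resolved-swap cxy (t , t≢cy , inj₂ e) = t , (λ t≡cx → t≢cy (trans t≡cx cxy)) , inj₁ e

summand≤1 : ∀ {D d E} → D ≡ d + E → D ≤ 2 → 1 ≤ E → d ≤ 1
summand≤1 {d = d} {suc E} refl D≤2 _ = m+n≤o⇒m≤o d (s≤s⁻¹ (subst (_≤ 2) (+-suc d E) D≤2))

Diameter≤2 : Graph → Set
Diameter≤2 G = ∀ x y → dist G x y ≤ 2

module DiameterTwo (G : Graph) (diam : Diameter≤2 G) {k : ℕ} (c : Fin (n G) → Fin k) where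
  open Walks G
  open Classes G c

  distClass≤2 : ∀ {x w t} → c w ≡ t → distClass G c x t ≤ 2
  distClass≤2 {x} {w} cw = ≤-trans (distClass-≤ cw) (diam x w)

  -- All class distances are 1 or 2, so d(x,W) = d(x,y) + d(y,W) with y ∉ W forces
  -- d(x,y) ≤ 1: a class can only strongly resolve vertices at distance 1.
  resolved⇒close : ∀ {x y t w} → c w ≡ t → c x ≢ t → c y ≢ t →
                   StronglyResolves G c t x y → dist G x y ≤ 1 ⊎ dist G y x ≤ 1
  resolved⇒close cw _ cy≢t (inj₁ e) =
    inj₁ (summand≤1 e (distClass≤2 cw) (distClass-outside cw cy≢t))
  resolved⇒close cw cx≢t _ (inj₂ e) =
    inj₂ (summand≤1 e (distClass≤2 cw) (distClass-outside cw cx≢t))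

  sameClass⇒close : IsStrongResolvingPartition G c → ∀ {x y} → x ≢ y → c x ≡ c y →
                    dist G x y ≤ 1 ⊎ dist G y x ≤ 1
  sameClass⇒close (partition , resolving) {x} {y} x≢y cxy with resolving x y x≢y cxy
  ... | t , t≢cx , resolves with partition t
  ...   | w , cw = resolved⇒close cw (λ cx≡t → t≢cx (sym cx≡t))
                     (λ cy≡t → t≢cx (sym (trans cxy cy≡t))) resolves

  spread⇒lowerBound : IsStrongResolvingPartition G c → {m : ℕ} (v : Fin m → Fin (n G)) →
                      (∀ i j → i ≢ j → 2 ≤ dist G (v i) (v j)) → m ≤ k
  spread⇒lowerBound srp v far = injective⇒≤ injective
    where
    far⇒distinct : ∀ {i j} → i ≢ j → v i ≢ v j
    far⇒distinct {i} {j} i≢j vi≡vj with () ←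
      subst (2 ≤_) (dist-self (v i)) (subst (λ z → 2 ≤ dist G (v i) z) (sym vi≡vj) (far i j i≢j))

    injective : ∀ {i j} → c (v i) ≡ c (v j) → i ≡ j
    injective {i} {j} same with i ≟ j
    ... | yes i≡j = i≡j
    ... | no i≢j with sameClass⇒close srp (far⇒distinct i≢j) same
    ...   | inj₁ close = ⊥-elim (≤⇒≯ close (far i j i≢j))
    ...   | inj₂ close = ⊥-elim (≤⇒≯ close (far j i (λ j≡i → i≢j (sym j≡i))))

  -- How a class resolves an adjacent pair x, y of another class: if W_t contains a
  -- neighbour w of y but no neighbour of x, then d(x,W_t) = 2 = d(x,y) + d(y,W_t).
  resolvedThrough : ∀ {x y w t} → c x ≡ c y → dist G x y ≡ 1 → t ≢ c x →
                    c w ≡ t → dist G y w ≡ 1 → (∀ w' → c w' ≡ t → 2 ≤ dist G x w') →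
                    Resolved x y
  resolvedThrough {x} {y} {w} {t} cxy xy t≢cx cw yw far = t , t≢cx , inj₁ (begin
    distClass G c x t               ≡⟨ ≤-antisym (distClass≤2 cw) (distClass-≥ cw far) ⟩
    1 + 1                           ≡⟨ cong₂ _+_ (sym xy) (sym y-near) ⟩
    dist G x y + distClass G c y t  ∎)
    where
    open ≡-Reasoning
    y-near : distClass G c y t ≡ 1
    y-near = ≤-antisym (subst (distClass G c y t ≤_) yw (distClass-≤ cw))
                       (distClass-outside cw λ cy≡t → t≢cx (sym (trans cxy cy≡t)))

Consecutive : ℕ → ℕ → Set
Consecutive a b = suc a ≡ b ⊎ suc b ≡ a

Apart : ℕ → ℕ → Set
Apart a b = 2 + a ≤ b ⊎ 2 + b ≤ a

consecutive⇒close : ∀ {a b} → Consecutive a b → b ≤ suc a × a ≤ suc b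
consecutive⇒close (inj₁ refl) = ≤-refl , m≤n⇒m≤1+n (n≤1+n _)
consecutive⇒close (inj₂ refl) = m≤n⇒m≤1+n (n≤1+n _) , ≤-refl

apart⇒¬consecutive : ∀ {a b} → Apart a b → ¬ Consecutive a b
apart⇒¬consecutive (inj₁ 2+a≤b) cons = 1+n≰n (≤-trans 2+a≤b (proj₁ (consecutive⇒close cons)))
apart⇒¬consecutive (inj₂ 2+b≤a) cons = 1+n≰n (≤-trans 2+b≤a (proj₂ (consecutive⇒close cons)))

consecutive⇒≢ : ∀ {a b} → Consecutive a b → a ≢ b
consecutive⇒≢ (inj₁ sa≡b) a≡b = 1+n≢n (trans sa≡b (sym a≡b))
consecutive⇒≢ (inj₂ sb≡a) a≡b = 1+n≢n (trans sb≡a a≡b)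

apart⇒≢ : ∀ {a b} → Apart a b → a ≢ b
apart⇒≢ (inj₁ 2+a≤b) refl = 1+n≰n (≤-trans (n≤1+n _) 2+a≤b)
apart⇒≢ (inj₂ 2+b≤a) refl = 1+n≰n (≤-trans (n≤1+n _) 2+b≤a)

adjNat-consecutive : ∀ {a b} → Consecutive a b → adjNat a b ≡ true
adjNat-consecutive {a} {b} (inj₁ e) = cong (_∨ (suc b ≡ᵇ a)) (dec-true (suc a ≟ℕ b) e)
adjNat-consecutive {a} {b} (inj₂ e) =
  trans (cong ((suc a ≡ᵇ b) ∨_) (dec-true (suc b ≟ℕ a) e)) (∨-zeroʳ _)

adjNat-apart : ∀ {a b} → Apart a b → adjNat a b ≡ false
adjNat-apart {a} {b} apart
  rewrite dec-false (suc a ≟ℕ b) (λ e → apart⇒¬consecutive apart (inj₁ e))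
        | dec-false (suc b ≟ℕ a) (λ e → apart⇒¬consecutive apart (inj₂ e)) = refl

suc-double : ∀ a → suc a + suc a ≡ suc (suc (a + a))
suc-double a = cong suc (+-suc a a)

doubles-apart : ∀ {a b} → a ≢ b → Apart (a + a) (b + b)
doubles-apart {a} {b} a≢b with <-cmp a b
... | tri< a<b _ _ = inj₁ (subst (_≤ b + b) (suc-double a) (+-mono-≤ a<b a<b))
... | tri≈ _ a≡b _ = ⊥-elim (a≢b a≡b)
... | tri> _ _ b<a = inj₂ (subst (_≤ a + a) (suc-double b) (+-mono-≤ b<a b<a))

double< : ∀ {m r} → m < ⌈ r /2⌉ → m + m < r
double< {m} {r} m<⌈r/2⌉ = ≰⇒> λ r≤m+m →
  ≤⇒≯ (subst (⌈ r /2⌉ ≤_) (sym (n≡⌈n+n/2⌉ m)) (⌈n/2⌉-mono r≤m+m)) m<⌈r/2⌉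

module Fan (r : ℕ) where
  open Walks (fan r)

  hub : Fin (suc r)
  hub = zero

  path : Fin r → Fin (suc r)
  path = suc

  vertex-cases : (P : Fin (suc r) → Set) → P hub → ((i : Fin r) → P (path i)) → ∀ x → P x
  vertex-cases P at-hub at-path zero    = at-hub
  vertex-cases P at-hub at-path (suc i) = at-path i

  hub-path : (j : Fin r) → dist (fan r) hub (path j) ≡ 1
  hub-path j = dist-edge {hub} {path j} (λ ()) refl

  path-hub : (j : Fin r) → dist (fan r) (path j) hub ≡ 1
  path-hub j = dist-edge {path j} {hub} (λ ()) refl

  path-consecutive : {i j : Fin r} → Consecutive (toℕ i) (toℕ j) → dist (fan r) (path i) (path j) ≡ 1
  path-consecutive cons =
    dist-edge (λ e → consecutive⇒≢ cons (cong toℕ (suc-injective e))) (adjNat-consecutive cons)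

  path-apart : {i j : Fin r} → Apart (toℕ i) (toℕ j) → 2 ≤ dist (fan r) (path i) (path j)
  path-apart apart =
    dist-nonadjacent (λ e → apart⇒≢ apart (cong toℕ (suc-injective e))) (adjNat-apart apart)

  diameter≤2 : Diameter≤2 (fan r)
  diameter≤2 zero    zero    = ≤-trans (dist-≤ {zero} {zero} (reach-refl zero)) z≤n
  diameter≤2 zero    (suc j) =
    ≤-trans (dist-≤ {zero} {suc j} (reach-edge {zero} {suc j} refl)) (s≤s z≤n)
  diameter≤2 (suc i) zero    =
    ≤-trans (dist-≤ {suc i} {zero} (reach-edge {suc i} {zero} refl)) (s≤s z≤n)
  diameter≤2 (suc i) (suc j) = dist-common-neighbour {suc i} {zero} {suc j} refl refl

  evenPosition : Fin ⌈ r /2⌉ → Fin r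
  evenPosition t = fromℕ< (double< (toℕ<n t))

  toℕ-evenPosition : (t : Fin ⌈ r /2⌉) → toℕ (evenPosition t) ≡ toℕ t + toℕ t
  toℕ-evenPosition t = toℕ-fromℕ< _

  lowerBound : ∀ {k} (c : Fin (suc r) → Fin k) → IsStrongResolvingPartition (fan r) c →
               ⌈ r /2⌉ ≤ k
  lowerBound c srp = spread⇒lowerBound srp (λ t → path (evenPosition t)) evens-apart
    where
    open DiameterTwo (fan r) diameter≤2 c
    evens-apart : ∀ s t → s ≢ t → 2 ≤ dist (fan r) (path (evenPosition s)) (path (evenPosition t))
    evens-apart s t s≢t = path-apart
      (subst₂ Apart (sym (toℕ-evenPosition s)) (sym (toℕ-evenPosition t))
                    (doubles-apart λ e → s≢t (toℕ-injective e)))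

halves : ∀ {a m} → ⌊ a /2⌋ ≡ m → a ≡ m + m ⊎ a ≡ suc (m + m)
halves {zero}        refl = inj₁ refl
halves {suc zero}    refl = inj₂ refl
halves {suc (suc a)} refl with halves {a} refl
... | inj₁ e = inj₁ (trans (cong (λ b → suc (suc b)) e) (sym (suc-double _)))
... | inj₂ e = inj₂ (cong suc (trans (cong suc e) (sym (suc-double _))))

half-bounds : ∀ {a m} → ⌊ a /2⌋ ≡ m → m + m ≤ a × a ≤ suc (m + m)
half-bounds h with halves h
... | inj₁ refl = ≤-refl , n≤1+n _
... | inj₂ refl = n≤1+n _ , ≤-refl

bounds⇒apart : ∀ {a b m} → m + m ≤ b × b ≤ suc (m + m) →
               3 + (m + m) ≤ a ⊎ 2 + a ≤ m + m → Apart a b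
bounds⇒apart (_ , upper) (inj₁ beyond) = inj₂ (≤-trans (s≤s (s≤s upper)) beyond)
bounds⇒apart (lower , _) (inj₂ before) = inj₁ (≤-trans before lower)

-- For r = 5 + s, the partition of F_{1,r} into the path pairs {2m, 2m+1} (the last one
-- possibly a single vertex), with the hub added to the last class, is strongly resolving.
module PairPartition (s : ℕ) where
  r : ℕ
  r = 5 + s
  open Fan r

  -- Index of the last class; the classes are 0, …, L and ⌈r/2⌉ = L + 1.
  L : ℕ
  L = 2 + ⌊ s /2⌋

  -- The path vertex at position a lies in class ⌊a/2⌋, the hub in class L.
  classOf : Fin (suc r) → Fin ⌈ r /2⌉
  classOf zero    = fromℕ L
  classOf (suc i) = fromℕ< (⌈n/2⌉-mono (toℕ<n i))

  toℕ-classOf-hub : toℕ (classOf hub) ≡ L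
  toℕ-classOf-hub = toℕ-fromℕ L

  toℕ-classOf-path : ∀ {i a} → toℕ i ≡ a → toℕ (classOf (path i)) ≡ ⌊ a /2⌋
  toℕ-classOf-path {i} refl = toℕ-fromℕ< (⌈n/2⌉-mono (toℕ<n i))

  isPartition : IsPartition (fan r) classOf
  isPartition t = path (evenPosition t) ,
    toℕ-injective (trans (toℕ-classOf-path (toℕ-evenPosition t)) (sym (n≡⌊n+n/2⌋ (toℕ t))))

  farFromClass : ∀ {i : Fin r} {t} → toℕ t ≢ L →
                 3 + (toℕ t + toℕ t) ≤ toℕ i ⊎ 2 + toℕ i ≤ toℕ t + toℕ t →
                 ∀ w → classOf w ≡ t → 2 ≤ dist (fan r) (path i) w
  farFromClass {i} {t} t≢L far =
    vertex-cases (λ w → classOf w ≡ t → 2 ≤ dist (fan r) (path i) w)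
                 (λ hub∈t → ⊥-elim (hub-outside hub∈t)) path-far
    where
    hub-outside : classOf hub ≢ t
    hub-outside hub∈t = t≢L (trans (cong toℕ (sym hub∈t)) toℕ-classOf-hub)
    path-far : (j : Fin r) → classOf (path j) ≡ t → 2 ≤ dist (fan r) (path i) (path j)
    path-far j refl = path-apart {i} {j}
      (bounds⇒apart {m = toℕ t} (half-bounds (sym (toℕ-classOf-path refl))) far)

  open Classes (fan r) classOf using (Resolved; resolved-swap)
  open DiameterTwo (fan r) diameter≤2 classOf using (resolvedThrough)

  -- The hub and a path vertex j of the last class (so j ≥ 2L ≥ 4) are resolved by
  -- class 0 = {0, 1}: the hub is adjacent to position 0, while j is far from it.
  hub-resolved : (j : Fin r) → classOf hub ≡ classOf (path j) → Resolved hub (path j)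
  hub-resolved j same = resolved-swap {hub} {path j} same
    (resolvedThrough {path j} {hub} {path zero} {zero} (sym same)
       (path-hub j) 0≢class refl (hub-path zero) (farFromClass {j} {zero} (λ ()) (inj₁ 3≤j)))
    where
    j-last : ⌊ toℕ j /2⌋ ≡ L
    j-last = trans (sym (toℕ-classOf-path refl)) (trans (cong toℕ (sym same)) toℕ-classOf-hub)
    3≤j : 3 ≤ toℕ j
    3≤j = ≤-trans (+-mono-≤ {2} {L} {1} {L} (s≤s (s≤s z≤n)) (s≤s z≤n))
                  (proj₁ (half-bounds j-last))
    0≢class : zero ≢ classOf (path j)
    0≢class e with () ← trans (cong toℕ e) (trans (toℕ-classOf-path refl) j-last)

  -- The pair at positions 2m+1 (i) and 2m (j) is resolved by class 1 = {2, 3} when m = 0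
  -- (position 2 is next to 1 but far from 0), and by class m − 1 = {2m−2, 2m−1} otherwise
  -- (position 2m−1 is next to 2m but far from 2m+1).
  pair-resolved : ∀ m (i j : Fin r) → toℕ i ≡ suc (m + m) → toℕ j ≡ m + m →
                  classOf (path i) ≡ classOf (path j) → Resolved (path i) (path j)
  pair-resolved zero i j i≡1 j≡0 same =
    resolved-swap {path i} {path j} same
      (resolvedThrough {path j} {path i} {w} {class1} (sym same) j~i class1≢ refl i~w far)
    where
    class1 : Fin ⌈ r /2⌉
    class1 = suc zero
    w : Fin (suc r)
    w = path (suc (suc zero))
    j~i : dist (fan r) (path j) (path i) ≡ 1
    j~i = path-consecutive {j} {i} (inj₁ (trans (cong suc j≡0) (sym i≡1)))
    i~w : dist (fan r) (path i) w ≡ 1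
    i~w = path-consecutive {i} {suc (suc zero)} (inj₁ (cong suc i≡1))
    class1≢ : class1 ≢ classOf (path j)
    class1≢ e with () ← trans (cong toℕ e) (toℕ-classOf-path j≡0)
    far : ∀ w′ → classOf w′ ≡ class1 → 2 ≤ dist (fan r) (path j) w′
    far = farFromClass {j} {class1} (λ ()) (inj₂ (≤-reflexive (cong (2 +_) j≡0)))
  pair-resolved (suc m) i j i≡ j≡ same =
    resolvedThrough {path i} {path j} {w} {classOf w} same i~j t≢ refl j~w far
    where
    j≡′ : toℕ j ≡ 2 + (m + m)
    j≡′ = trans j≡ (suc-double m)
    i≡′ : toℕ i ≡ 3 + (m + m)
    i≡′ = trans i≡ (cong suc (suc-double m))
    w<r : suc (m + m) < r
    w<r = ≤-trans (≤-reflexive (sym j≡′)) (<⇒≤ (toℕ<n j))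
    w : Fin (suc r)
    w = path (fromℕ< w<r)
    toℕ-t : toℕ (classOf w) ≡ m
    toℕ-t = trans (toℕ-classOf-path (toℕ-fromℕ< w<r)) (sym (n≡⌈n+n/2⌉ m))
    toℕ-class : toℕ (classOf (path j)) ≡ suc m
    toℕ-class = trans (toℕ-classOf-path j≡) (sym (n≡⌊n+n/2⌋ (suc m)))
    t≢ : classOf w ≢ classOf (path i)
    t≢ e = 1+n≢n (trans (sym toℕ-class) (trans (cong toℕ (sym (trans e same))) toℕ-t))
    t≢L : toℕ (classOf w) ≢ L
    t≢L = subst (_≢ L) (sym toℕ-t)
            (<⇒≢ (s≤s⁻¹ (subst (_< suc L) toℕ-class (toℕ<n (classOf (path j))))))
    i~j : dist (fan r) (path i) (path j) ≡ 1
    i~j = path-consecutive {i} {j} (inj₂ (trans (cong suc j≡) (sym i≡)))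
    j~w : dist (fan r) (path j) w ≡ 1
    j~w = path-consecutive {j} {fromℕ< w<r} (inj₂ (trans (cong suc (toℕ-fromℕ< w<r)) (sym j≡′)))
    far : ∀ w′ → classOf w′ ≡ classOf w → 2 ≤ dist (fan r) (path i) w′
    far = farFromClass {i} {classOf w} t≢L
            (inj₁ (≤-reflexive (trans (cong (λ a → 3 + (a + a)) toℕ-t) (sym i≡′))))

  same-half : {i j : Fin r} → classOf (path i) ≡ classOf (path j) →
              ⌊ toℕ j /2⌋ ≡ ⌊ toℕ i /2⌋
  same-half same =
    trans (sym (toℕ-classOf-path refl)) (trans (cong toℕ (sym same)) (toℕ-classOf-path refl))

  path-resolved : (i j : Fin r) → path i ≢ path j → classOf (path i) ≡ classOf (path j) →
                  Resolved (path i) (path j)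
  path-resolved i j i≢j same = by-parity (halves {toℕ i} refl) (halves {toℕ j} (same-half same))
    where
    m : ℕ
    m = ⌊ toℕ i /2⌋
    equal-positions : toℕ i ≡ toℕ j → Resolved (path i) (path j)
    equal-positions i≡j = ⊥-elim (i≢j (cong suc (toℕ-injective i≡j)))
    by-parity : toℕ i ≡ m + m ⊎ toℕ i ≡ suc (m + m) →
                toℕ j ≡ m + m ⊎ toℕ j ≡ suc (m + m) → Resolved (path i) (path j)
    by-parity (inj₁ i≡) (inj₁ j≡) = equal-positions (trans i≡ (sym j≡))
    by-parity (inj₂ i≡) (inj₂ j≡) = equal-positions (trans i≡ (sym j≡))
    by-parity (inj₂ i≡) (inj₁ j≡) = pair-resolved m i j i≡ j≡ same
    by-parity (inj₁ i≡) (inj₂ j≡) =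
      resolved-swap {path i} {path j} same (pair-resolved m j i j≡ i≡ (sym same))

  isStrongResolving : IsStrongResolvingPartition (fan r) classOf
  isStrongResolving = isPartition , resolving
    where
    ResolvedIfClassmates : Fin (suc r) → Fin (suc r) → Set
    ResolvedIfClassmates x y = x ≢ y → classOf x ≡ classOf y → Resolved x y
    resolving : ∀ x y → ResolvedIfClassmates x y
    resolving = vertex-cases (λ x → ∀ y → ResolvedIfClassmates x y)
      (vertex-cases (ResolvedIfClassmates hub)
        (λ hub≢hub _ → ⊥-elim (hub≢hub refl))
        (λ j _ same → hub-resolved j same))
      (λ i → vertex-cases (ResolvedIfClassmates (path i))
        (λ _ same → resolved-swap {path i} {hub} same (hub-resolved i (sym same)))
        (λ j i≢j same → path-resolved i j i≢j same))

  dimension : StrongPartitionDimension (fan r) ⌈ r /2⌉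
  dimension = (classOf , isStrongResolving) , λ k c srp → lowerBound c srp

isStrongResolvingPartition? : (G : Graph) {k : ℕ} (c : Fin (n G) → Fin k) →
                              Dec (IsStrongResolvingPartition G c)
isStrongResolvingPartition? G c =
  all? (λ t → any? λ v → c v ≟ t) ×-dec
  all? (λ x → all? λ y → ¬? (x ≟ y) →-dec (c x ≟ c y →-dec
    any? λ t → ¬? (t ≟ c x) ×-dec
      ((distClass G c x t ≟ℕ dist G x y + distClass G c y t) ⊎-dec
       (distClass G c y t ≟ℕ dist G y x + distClass G c x t))))

module _ (G : Graph) {k : ℕ} {c c′ : Fin (n G) → Fin k} (c≗c′ : ∀ x → c x ≡ c′ x) where

  distClass-pointwise : ∀ x t → distClass G c x t ≡ distClass G c′ x t
  distClass-pointwise x t = cong (λ ws → minList 0 (map (dist G x) ws))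
    (filter-≐ (λ w → c w ≟ t) (λ w → c′ w ≟ t)
              ((λ {w} e → trans (sym (c≗c′ w)) e) , (λ {w} e → trans (c≗c′ w) e)) (allFin (n G)))

  srp-pointwise : IsStrongResolvingPartition G c → IsStrongResolvingPartition G c′
  srp-pointwise (partition , resolving) = partition′ , resolving′
    where
    partition′ : IsPartition G c′
    partition′ t with partition t
    ... | v , cv = v , trans (sym (c≗c′ v)) cv
    resolving′ : ∀ x y → ¬ x ≡ y → c′ x ≡ c′ y → Classes.Resolved G c′ x y
    resolving′ x y x≢y same
      with resolving x y x≢y (trans (c≗c′ x) (trans same (sym (c≗c′ y))))
    ... | t , t≢cx , resolves = t , (λ t≡ → t≢cx (trans t≡ (sym (c≗c′ x)))) , transport resolves
      where
      transport : StronglyResolves G c t x y → StronglyResolves G c′ t x y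
      transport (inj₁ e) = inj₁ (trans (sym (distClass-pointwise x t))
                                       (trans e (cong (dist G x y +_) (distClass-pointwise y t))))
      transport (inj₂ e) = inj₂ (trans (sym (distClass-pointwise y t))
                                       (trans e (cong (dist G y x +_) (distClass-pointwise x t))))

all-vectors? : ∀ {k} m {P : Vec (Fin k) m → Set} → (∀ v → Dec (P v)) → Dec (∀ v → P v)
all-vectors? zero    P? = map′ (λ p → λ { [] → p }) (λ all → all []) (P? [])
all-vectors? (suc m) P? = map′ (λ all → λ { (a ∷ v) → all v a }) (λ all v a → all (a ∷ v))
                               (all-vectors? m λ v → all? λ a → P? (a ∷ v))

-- For small fans, a strong resolving 3-partition together with the absence of strong
-- resolving 2-partitions (checked over all label vectors) gives pd_s = 3; fewer than
-- two classes are already excluded by the general lower bound ⌈r/2⌉ ≥ 2.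
smallFan-dimension : ∀ r → 3 ≤ r →
  (c : Fin (suc r) → Fin 3) → IsStrongResolvingPartition (fan r) c →
  (∀ (v : Vec (Fin 2) (suc r)) → ¬ IsStrongResolvingPartition (fan r) (lookup v)) →
  StrongPartitionDimension (fan r) 3
smallFan-dimension r 3≤r c srp no-2 = (c , srp) , atLeast3
  where
  two≤ : ∀ {k} (c′ : Fin (suc r) → Fin k) → IsStrongResolvingPartition (fan r) c′ → 2 ≤ k
  two≤ c′ srp′ = ≤-trans (⌈n/2⌉-mono 3≤r) (Fan.lowerBound r c′ srp′)

  atLeast3 : ∀ k (c′ : Fin (suc r) → Fin k) → IsStrongResolvingPartition (fan r) c′ → 3 ≤ k
  atLeast3 zero          c′ srp′ with () ← two≤ c′ srp′
  atLeast3 (suc zero)    c′ srp′ with s≤s () ← two≤ c′ srp′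
  atLeast3 (suc (suc zero)) c′ srp′ =
    ⊥-elim (no-2 (tabulate c′) (srp-pointwise (fan r) (λ x → sym (lookup∘tabulate c′ x)) srp′))
  atLeast3 (suc (suc (suc _))) _ _ = s≤s (s≤s (s≤s z≤n))

fan3-dimension : StrongPartitionDimension (fan 3) 3
fan3-dimension = smallFan-dimension 3 (s≤s (s≤s (s≤s z≤n))) (lookup labels)
  (toWitness {a? = isStrongResolvingPartition? (fan 3) (lookup labels)} tt)
  (toWitness {a? = all-vectors? 4 λ v → ¬? (isStrongResolvingPartition? (fan 3) (lookup v))} tt)
  where
  labels : Vec (Fin 3) 4
  labels = # 0 ∷ # 0 ∷ # 1 ∷ # 2 ∷ []

fan4-dimension : StrongPartitionDimension (fan 4) 3
fan4-dimension = smallFan-dimension 4 (s≤s (s≤s (s≤s z≤n))) (lookup labels)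
  (toWitness {a? = isStrongResolvingPartition? (fan 4) (lookup labels)} tt)
  (toWitness {a? = all-vectors? 5 λ v → ¬? (isStrongResolvingPartition? (fan 4) (lookup v))} tt)
  where
  labels : Vec (Fin 3) 5
  labels = # 0 ∷ # 0 ∷ # 0 ∷ # 1 ∷ # 2 ∷ []

mainTheorem18 : (r : ℕ) → 3 ≤ r →
    (r ≤ 4 → StrongPartitionDimension (fan r) 3) ×
    (5 ≤ r → StrongPartitionDimension (fan r) ⌈ r /2⌉)
mainTheorem18 zero                                 ()
mainTheorem18 (suc zero)                           (s≤s ())
mainTheorem18 (suc (suc zero))                     (s≤s (s≤s ()))
mainTheorem18 (suc (suc (suc zero)))               _ =
  (λ _ → fan3-dimension) , λ { (s≤s (s≤s (s≤s ()))) }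
mainTheorem18 (suc (suc (suc (suc zero))))         _ =
  (λ _ → fan4-dimension) , λ { (s≤s (s≤s (s≤s (s≤s ())))) }
mainTheorem18 (suc (suc (suc (suc (suc s)))))      _ =
  (λ { (s≤s (s≤s (s≤s (s≤s ())))) }) , λ _ → PairPartition.dimension s
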